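{- Let $a_1,a_2,b_1,b_2,c_1,c_2$ be positive real numbers with $a_i\ge\max(b_i,c_i)$ for $i=1,2$, and let $\gamma>0$. Suppose that $a_i+\gamma c_i\ge(1+\gamma)b_i$ for $i=1,2$. Then $$a_1a_2+\gamma c_1c_2\ge(1+\gamma)b_1b_2.$$ -}

module Defs where

open import Level using (Level; _⊔_) renaming (suc to lsuc)
open import Algebra.Bundles using (CommutativeRing)
open import Relation.Binary.Core using (Rel)
open import Relation.Binary.Structures using (IsStrictTotalOrder)
open import Data.Sum using (_⊎_)

-- The real numbers are an instance.
record OrderedCommutativeRing (c ℓ₁ ℓ₂ : Level) : Set (lsuc (c ⊔ ℓ₁ ⊔ ℓ₂)) where
  infix 4 _<_ _≤_
  field
    commutativeRing : CommutativeRing c ℓ₁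
  open CommutativeRing commutativeRing public
  field
    _<_                : Rel Carrier ℓ₂
    isStrictTotalOrder : IsStrictTotalOrder _≈_ _<_
    +-monoˡ-<          : ∀ z {x y} → x < y → x + z < y + z
    *-pos              : ∀ {x y} → 0# < x → 0# < y → 0# < x * y

  _≤_ : Rel Carrier (ℓ₁ ⊔ ℓ₂)
  x ≤ y = x < y ⊎ x ≈ y

{-# OPTIONS --safe #-}
-- Write aᵢ = xᵢ + bᵢ and cᵢ = yᵢ + bᵢ. The hypotheses say xᵢ ≥ 0, yᵢ ≤ xᵢ and
-- xᵢ + γyᵢ ≥ 0, and the difference of the two sides of the claim is
--   b₁(x₂ + γy₂) + b₂(x₁ + γy₁) + (x₁x₂ + γy₁y₂).
-- Only the last summand needs an argument: if y₂ ≥ 0 it equals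
-- x₁(x₂ − y₂) + y₂(x₁ + γy₁), symmetrically if y₁ ≥ 0, and if both yᵢ are
-- negative then y₁y₂ = (−y₁)(−y₂) ≥ 0.
module Submission where

open import Defs
open import Data.Product using (_×_; _,_)
open import Data.Sum using (_⊎_; inj₁; inj₂)
open import Function.Base using (_∘_)
open import Relation.Binary.Definitions using (tri<; tri≈; tri>)
open import Relation.Binary.Structures using (IsStrictTotalOrder)

module OrderedCommutativeRingProperties {c ℓ₁ ℓ₂} (R : OrderedCommutativeRing c ℓ₁ ℓ₂) where
  open OrderedCommutativeRing R
  open IsStrictTotalOrder isStrictTotalOrder
    using (compare; <-respˡ-≈; <-respʳ-≈) renaming (trans to <-trans)
  open import Algebra.Properties.Ring ring using (-‿distribˡ-*; -‿distribʳ-*)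
  open import Algebra.Properties.Group +-group
    using (//-rightDividesˡ; //-rightDividesʳ; ⁻¹-involutive)
  -- The solver only knows the commutative semiring, so every identity below first
  -- removes subtraction by rewriting a as (a - b) + b and treating a - b as a variable.
  open import Algebra.Solver.Ring.NaturalCoefficients.Default commutativeSemiring
    using (solve; _:=_; _:+_; _:*_; con)
  open import Relation.Binary.Reasoning.Setoid setoid

  ≤-respʳ-≈ : ∀ {x y z} → y ≈ z → x ≤ y → x ≤ z
  ≤-respʳ-≈ y≈z (inj₁ x<y) = inj₁ (<-respʳ-≈ y≈z x<y)
  ≤-respʳ-≈ y≈z (inj₂ x≈y) = inj₂ (trans x≈y y≈z)

  ≤-respˡ-≈ : ∀ {x y z} → x ≈ z → x ≤ y → z ≤ y
  ≤-respˡ-≈ x≈z (inj₁ x<y) = inj₁ (<-respˡ-≈ x≈z x<y)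
  ≤-respˡ-≈ x≈z (inj₂ x≈y) = inj₂ (trans (sym x≈z) x≈y)

  ≤-resp-≈ : ∀ {x y u v} → x ≈ u → y ≈ v → x ≤ y → u ≤ v
  ≤-resp-≈ x≈u y≈v = ≤-respˡ-≈ x≈u ∘ ≤-respʳ-≈ y≈v

  ≤-trans : ∀ {x y z} → x ≤ y → y ≤ z → x ≤ z
  ≤-trans (inj₁ x<y) (inj₁ y<z) = inj₁ (<-trans x<y y<z)
  ≤-trans (inj₁ x<y) (inj₂ y≈z) = inj₁ (<-respʳ-≈ y≈z x<y)
  ≤-trans (inj₂ x≈y) y≤z        = ≤-respˡ-≈ (sym x≈y) y≤z

  +-monoˡ-≤ : ∀ z {x y} → x ≤ y → x + z ≤ y + z
  +-monoˡ-≤ z (inj₁ x<y) = inj₁ (+-monoˡ-< z x<y)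
  +-monoˡ-≤ z (inj₂ x≈y) = inj₂ (+-congʳ x≈y)

  +-cancelʳ-≤ : ∀ z {x y} → x + z ≤ y + z → x ≤ y
  +-cancelʳ-≤ z {x} {y} =
    ≤-resp-≈ (//-rightDividesʳ z x) (//-rightDividesʳ z y) ∘ +-monoˡ-≤ (- z)

  x≤y⇒0≤y-x : ∀ {x y} → x ≤ y → 0# ≤ y - x
  x≤y⇒0≤y-x {x} = ≤-respˡ-≈ (-‿inverseʳ x) ∘ +-monoˡ-≤ (- x)

  0≤y⇒x≤y+x : ∀ x {y} → 0# ≤ y → x ≤ y + x
  0≤y⇒x≤y+x x = ≤-respˡ-≈ (+-identityˡ x) ∘ +-monoˡ-≤ x

  nonNeg+nonNeg⇒nonNeg : ∀ {x y} → 0# ≤ x → 0# ≤ y → 0# ≤ x + y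
  nonNeg+nonNeg⇒nonNeg 0≤x 0≤y = ≤-trans 0≤y (0≤y⇒x≤y+x _ 0≤x)

  nonNeg*nonNeg⇒nonNeg : ∀ {x y} → 0# ≤ x → 0# ≤ y → 0# ≤ x * y
  nonNeg*nonNeg⇒nonNeg           (inj₁ 0<x) (inj₁ 0<y) = inj₁ (*-pos 0<x 0<y)
  nonNeg*nonNeg⇒nonNeg {x} {y} (inj₂ 0≈x) _          = inj₂ (sym (trans (*-congʳ (sym 0≈x)) (zeroˡ y)))
  nonNeg*nonNeg⇒nonNeg {x} {y} (inj₁ _)   (inj₂ 0≈y) = inj₂ (sym (trans (*-congˡ (sym 0≈y)) (zeroʳ x)))

  0≤x⊎0≤-x : ∀ x → 0# ≤ x ⊎ 0# ≤ - x
  0≤x⊎0≤-x x with compare 0# x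
  ... | tri< 0<x _ _ = inj₁ (inj₁ 0<x)
  ... | tri≈ _ 0≈x _ = inj₁ (inj₂ 0≈x)
  ... | tri> _ _ x<0 = inj₂ (≤-respʳ-≈ (+-identityˡ (- x)) (x≤y⇒0≤y-x (inj₁ x<0)))

  -x*-y≈x*y : ∀ x y → - x * - y ≈ x * y
  -x*-y≈x*y x y = begin
    - x * - y     ≈⟨ -‿distribˡ-* x (- y) ⟨
    - (x * - y)   ≈⟨ -‿cong (-‿distribʳ-* x y) ⟨
    - - (x * y)   ≈⟨ ⁻¹-involutive (x * y) ⟩
    x * y         ∎

  0≤x₁x₂+γy₁y₂-if-0≤y₂ : ∀ {γ x₁ x₂ y₁ y₂} → 0# ≤ x₁ → y₂ ≤ x₂ → 0# ≤ y₂ →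
                         0# ≤ x₁ + γ * y₁ → 0# ≤ x₁ * x₂ + γ * (y₁ * y₂)
  0≤x₁x₂+γy₁y₂-if-0≤y₂ {γ} {x₁} {x₂} {y₁} {y₂} 0≤x₁ y₂≤x₂ 0≤y₂ 0≤x₁+γy₁ =
    ≤-respʳ-≈ regroup
      (nonNeg+nonNeg⇒nonNeg (nonNeg*nonNeg⇒nonNeg 0≤x₁ (x≤y⇒0≤y-x y₂≤x₂))
                            (nonNeg*nonNeg⇒nonNeg 0≤y₂ 0≤x₁+γy₁))
    where
    regroup : x₁ * (x₂ - y₂) + y₂ * (x₁ + γ * y₁) ≈ x₁ * x₂ + γ * (y₁ * y₂)
    regroup = begin
      x₁ * (x₂ - y₂) + y₂ * (x₁ + γ * y₁)
        ≈⟨ solve 5 (λ x₁ e y₁ y₂ γ →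
             x₁ :* e :+ y₂ :* (x₁ :+ γ :* y₁) := x₁ :* (e :+ y₂) :+ γ :* (y₁ :* y₂))
             refl x₁ (x₂ - y₂) y₁ y₂ γ ⟩
      x₁ * ((x₂ - y₂) + y₂) + γ * (y₁ * y₂)
        ≈⟨ +-congʳ (*-congˡ (//-rightDividesˡ y₂ x₂)) ⟩
      x₁ * x₂ + γ * (y₁ * y₂) ∎

  0≤x₁x₂+γy₁y₂ : ∀ {γ x₁ x₂ y₁ y₂} → 0# ≤ γ → 0# ≤ x₁ → 0# ≤ x₂ → y₁ ≤ x₁ → y₂ ≤ x₂ →
                 0# ≤ x₁ + γ * y₁ → 0# ≤ x₂ + γ * y₂ → 0# ≤ x₁ * x₂ + γ * (y₁ * y₂)
  0≤x₁x₂+γy₁y₂ {γ} {x₁} {x₂} {y₁} {y₂} 0≤γ 0≤x₁ 0≤x₂ y₁≤x₁ y₂≤x₂ 0≤x₁+γy₁ 0≤x₂+γy₂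
    with 0≤x⊎0≤-x y₂ | 0≤x⊎0≤-x y₁
  ... | inj₁ 0≤y₂ | _ = 0≤x₁x₂+γy₁y₂-if-0≤y₂ 0≤x₁ y₂≤x₂ 0≤y₂ 0≤x₁+γy₁
  ... | inj₂ _ | inj₁ 0≤y₁ =
    ≤-respʳ-≈ (+-cong (*-comm x₂ x₁) (*-congˡ (*-comm y₂ y₁)))
      (0≤x₁x₂+γy₁y₂-if-0≤y₂ 0≤x₂ y₁≤x₁ 0≤y₁ 0≤x₂+γy₂)
  ... | inj₂ 0≤-y₂ | inj₂ 0≤-y₁ =
    nonNeg+nonNeg⇒nonNeg (nonNeg*nonNeg⇒nonNeg 0≤x₁ 0≤x₂)
      (nonNeg*nonNeg⇒nonNeg 0≤γ
        (≤-respʳ-≈ (-x*-y≈x*y y₁ y₂) (nonNeg*nonNeg⇒nonNeg 0≤-y₁ 0≤-y₂)))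

  0≤[a-b]+γ[c-b] : ∀ {a b c γ} → (1# + γ) * b ≤ a + γ * c → 0# ≤ (a - b) + γ * (c - b)
  0≤[a-b]+γ[c-b] {a} {b} {c} {γ} =
    +-cancelʳ-≤ ((1# + γ) * b) ∘ ≤-resp-≈ (sym (+-identityˡ _)) regroup
    where
    regroup : a + γ * c ≈ ((a - b) + γ * (c - b)) + (1# + γ) * b
    regroup = begin
      a + γ * c
        ≈⟨ +-cong (//-rightDividesˡ b a) (*-congˡ (//-rightDividesˡ b c)) ⟨
      ((a - b) + b) + γ * ((c - b) + b)
        ≈⟨ solve 4 (λ x y b γ →
             (x :+ b) :+ γ :* (y :+ b) := (x :+ γ :* y) :+ (con 1 :+ γ) :* b)
             refl (a - b) (c - b) b γ ⟩
      ((a - b) + γ * (c - b)) + (1# + γ) * b ∎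

  [1+γ]b₁b₂≤a₁a₂+γc₁c₂ : ∀ {a₁ a₂ b₁ b₂ c₁ c₂ γ} → 0# ≤ b₁ → 0# ≤ b₂ → 0# ≤ γ →
    b₁ ≤ a₁ → b₂ ≤ a₂ → c₁ ≤ a₁ → c₂ ≤ a₂ →
    (1# + γ) * b₁ ≤ a₁ + γ * c₁ → (1# + γ) * b₂ ≤ a₂ + γ * c₂ →
    (1# + γ) * (b₁ * b₂) ≤ a₁ * a₂ + γ * (c₁ * c₂)
  [1+γ]b₁b₂≤a₁a₂+γc₁c₂ {a₁} {a₂} {b₁} {b₂} {c₁} {c₂} {γ}
    0≤b₁ 0≤b₂ 0≤γ b₁≤a₁ b₂≤a₂ c₁≤a₁ c₂≤a₂ h₁ h₂ =
    ≤-respʳ-≈ (sym expand) (0≤y⇒x≤y+x _ 0≤excess)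
    where
    x₁ = a₁ - b₁
    x₂ = a₂ - b₂
    y₁ = c₁ - b₁
    y₂ = c₂ - b₂

    0≤x₁+γy₁ : 0# ≤ x₁ + γ * y₁
    0≤x₁+γy₁ = 0≤[a-b]+γ[c-b] h₁

    0≤x₂+γy₂ : 0# ≤ x₂ + γ * y₂
    0≤x₂+γy₂ = 0≤[a-b]+γ[c-b] h₂

    0≤excess : 0# ≤ (b₁ * (x₂ + γ * y₂) + b₂ * (x₁ + γ * y₁)) + (x₁ * x₂ + γ * (y₁ * y₂))
    0≤excess = nonNeg+nonNeg⇒nonNeg
      (nonNeg+nonNeg⇒nonNeg (nonNeg*nonNeg⇒nonNeg 0≤b₁ 0≤x₂+γy₂)
                            (nonNeg*nonNeg⇒nonNeg 0≤b₂ 0≤x₁+γy₁))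
      (0≤x₁x₂+γy₁y₂ 0≤γ (x≤y⇒0≤y-x b₁≤a₁) (x≤y⇒0≤y-x b₂≤a₂)
        (+-monoˡ-≤ (- b₁) c₁≤a₁) (+-monoˡ-≤ (- b₂) c₂≤a₂) 0≤x₁+γy₁ 0≤x₂+γy₂)

    expand : a₁ * a₂ + γ * (c₁ * c₂) ≈
             ((b₁ * (x₂ + γ * y₂) + b₂ * (x₁ + γ * y₁)) + (x₁ * x₂ + γ * (y₁ * y₂)))
             + (1# + γ) * (b₁ * b₂)
    expand = begin
      a₁ * a₂ + γ * (c₁ * c₂)
        ≈⟨ +-cong (*-cong (//-rightDividesˡ b₁ a₁) (//-rightDividesˡ b₂ a₂))
                  (*-congˡ (*-cong (//-rightDividesˡ b₁ c₁) (//-rightDividesˡ b₂ c₂))) ⟨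
      (x₁ + b₁) * (x₂ + b₂) + γ * ((y₁ + b₁) * (y₂ + b₂))
        ≈⟨ solve 7 (λ x₁ x₂ y₁ y₂ b₁ b₂ γ →
             (x₁ :+ b₁) :* (x₂ :+ b₂) :+ γ :* ((y₁ :+ b₁) :* (y₂ :+ b₂))
             := ((b₁ :* (x₂ :+ γ :* y₂) :+ b₂ :* (x₁ :+ γ :* y₁)) :+ (x₁ :* x₂ :+ γ :* (y₁ :* y₂)))
                :+ (con 1 :+ γ) :* (b₁ :* b₂))
             refl x₁ x₂ y₁ y₂ b₁ b₂ γ ⟩
      ((b₁ * (x₂ + γ * y₂) + b₂ * (x₁ + γ * y₁)) + (x₁ * x₂ + γ * (y₁ * y₂)))
        + (1# + γ) * (b₁ * b₂) ∎

lemma4p1 : ∀ {c ℓ₁ ℓ₂} (R : OrderedCommutativeRing c ℓ₁ ℓ₂) →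
    let open OrderedCommutativeRing R in
    ∀ (a₁ a₂ b₁ b₂ c₁ c₂ γ : Carrier) →
    0# < a₁ → 0# < a₂ → 0# < b₁ → 0# < b₂ → 0# < c₁ → 0# < c₂ →
    (b₁ ≤ a₁ × c₁ ≤ a₁) → (b₂ ≤ a₂ × c₂ ≤ a₂) →
    0# < γ →
    (1# + γ) * b₁ ≤ a₁ + γ * c₁ →
    (1# + γ) * b₂ ≤ a₂ + γ * c₂ →
    (1# + γ) * (b₁ * b₂) ≤ a₁ * a₂ + γ * (c₁ * c₂)
lemma4p1 R _ _ _ _ _ _ _ _ _ 0<b₁ 0<b₂ _ _ (b₁≤a₁ , c₁≤a₁) (b₂≤a₂ , c₂≤a₂) 0<γ h₁ h₂ =
  [1+γ]b₁b₂≤a₁a₂+γc₁c₂ (inj₁ 0<b₁) (inj₁ 0<b₂) (inj₁ 0<γ) b₁≤a₁ b₂≤a₂ c₁≤a₁ c₂≤a₂ h₁ h₂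
  where open OrderedCommutativeRingProperties R
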